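{- Let $d$ be an integer with $d\neq -3$ and let $(x,y)\in\mathbb{Z}^2$ satisfy $x^3+y^3+dxy+1=0$. Then there exists a (nonzero) integer $d_1$ dividing $d^3+27$ such that, for one choice of the sign $\pm$, $$x=\frac{3dd_1+3d_1^2\pm\sqrt{ -27d^2d_1^2-18dd_1^3-3d_1^4-12(d^3+27)d_1}}{18d_1},\qquad y=\frac{d+d_1-3x}{3}.$$ -}

module Defs where

open import Data.Integer using (ℤ; _+_; _*_; -_; _-_; +_)

radicand : ℤ → ℤ → ℤ
radicand d d₁ =
  - (+ 27) * (d * d) * (d₁ * d₁)
  - (+ 18) * d * (d₁ * d₁ * d₁)
  - (+ 3) * (d₁ * d₁ * d₁ * d₁)
  - (+ 12) * (d * d * d + + 27) * d₁

{-# OPTIONS --safe #-}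
module Submission where

-- Euler's factorisation a³ + b³ + c³ - 3abc = (a + b + c)(a² + b² + c² - ab - bc - ca)
-- at a = 3x, b = 3y, c = -d shows that on the curve d³ + 27 is a multiple of
-- d₁ = 3x + 3y - d; if d₁ were 0 then d³ = (-3)³, and cubing is injective on ℤ.
-- Eliminating y through 3y = d + d₁ - 3x turns the curve into a quadratic in x:
-- (18 d₁ x - 3 d d₁ - 3 d₁²)² - radicand = 324 d₁ (x³ + y³ + dxy + 1), so the
-- radicand is the square of 18 d₁ x - 3 d d₁ - 3 d₁², whose sign is the ±.

open import Defs
open import Data.Integer
  using (ℤ; _+_; _*_; -_; _-_; +_; -[1+_]; _≤_; 0ℤ; +≤+; ∣_∣)
open import Data.Integer.Divisibility using (_∣_)
open import Data.Integer.Divisibility.Signed as Signed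
  using (divides; ∣-refl; ∣m⇒∣m*n; ∣n⇒∣m*n; ∣m∣n⇒∣m-n; ∣⇒∣ᵤ; 0∣⇒≡0)
open import Data.Integer.Properties
  using (+-injective; pos-*; i*j≡0⇒i≡0∨j≡0; i≡j⇒i-j≡0; i-j≡0⇒i≡j; *-zeroʳ)
open import Data.Integer.Tactic.RingSolver using (solve-∀)
import Data.Nat as ℕ
import Data.Nat.Properties as ℕ
open import Data.Product using (∃-syntax; _×_; _,_)
open import Data.Sum using (_⊎_; inj₁; inj₂; reduce)
open import Relation.Binary.PropositionalEquality
  using (_≡_; _≢_; refl; sym; trans; cong; cong₂; subst; module ≡-Reasoning)

square≡+∣i∣*∣i∣ : ∀ i → i * i ≡ + (∣ i ∣ ℕ.* ∣ i ∣)
square≡+∣i∣*∣i∣ (+ n)    = sym (pos-* n n)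
square≡+∣i∣*∣i∣ -[1+ n ] = refl

square≡0⇒≡0 : ∀ i → i * i ≡ 0ℤ → i ≡ 0ℤ
square≡0⇒≡0 i i²≡0 = reduce (i*j≡0⇒i≡0∨j≡0 i i²≡0)

square+3*square≡0⇒≡0 : ∀ i j → i * i + + 3 * (j * j) ≡ 0ℤ → j ≡ 0ℤ
square+3*square≡0⇒≡0 i j eq =
  square≡0⇒≡0 j (trans (square≡+∣i∣*∣i∣ j) (cong +_ ∣j∣²≡0))
  where
  open ≡-Reasoning
  a b : ℕ.ℕ
  a = ∣ i ∣ ℕ.* ∣ i ∣
  b = ∣ j ∣ ℕ.* ∣ j ∣
  a+3b≡0 : a ℕ.+ 3 ℕ.* b ≡ 0
  a+3b≡0 = +-injective (begin
    + a + + (3 ℕ.* b)      ≡⟨ cong₂ _+_ (sym (square≡+∣i∣*∣i∣ i))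
                                        (trans (pos-* 3 b) (cong (+ 3 *_) (sym (square≡+∣i∣*∣i∣ j)))) ⟩
    i * i + + 3 * (j * j)  ≡⟨ eq ⟩
    0ℤ                     ∎)
  ∣j∣²≡0 : b ≡ 0
  ∣j∣²≡0 = ℕ.m*n≡0⇒m≡0 b 3 (trans (ℕ.*-comm b 3) (ℕ.m+n≡0⇒n≡0 a a+3b≡0))

difference-of-cubes : ∀ i j → i * i * i - j * j * j ≡ (i - j) * (i * i + i * j + j * j)
difference-of-cubes = solve-∀

completed-square : ∀ i j → (+ 2 * i + j) * (+ 2 * i + j) + + 3 * (j * j) ≡ + 4 * (i * i + i * j + j * j)
completed-square = solve-∀

quadratic-form-symmetric : ∀ i j → i * i + i * j + j * j ≡ j * j + j * i + i * i
quadratic-form-symmetric = solve-∀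

quadratic-form≡0⇒≡0 : ∀ i j → i * i + i * j + j * j ≡ 0ℤ → j ≡ 0ℤ
quadratic-form≡0⇒≡0 i j q≡0 =
  square+3*square≡0⇒≡0 (+ 2 * i + j) j (trans (completed-square i j) (cong (+ 4 *_) q≡0))

cube-injective : ∀ i j → i * i * i ≡ j * j * j → i ≡ j
cube-injective i j i³≡j³
  with i*j≡0⇒i≡0∨j≡0 (i - j) (trans (sym (difference-of-cubes i j)) (i≡j⇒i-j≡0 i³≡j³))
... | inj₁ i-j≡0 = i-j≡0⇒i≡j i j i-j≡0
... | inj₂ q≡0   = trans (quadratic-form≡0⇒≡0 j i (trans (quadratic-form-symmetric j i) q≡0))
                         (sym (quadratic-form≡0⇒≡0 i j q≡0))

cube+27≡0⇒≡-3 : ∀ d → d * d * d + + 27 ≡ 0ℤ → d ≡ - + 3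
cube+27≡0⇒≡-3 d eq = cube-injective d (- + 3) (i-j≡0⇒i≡j (d * d * d) (- + 3 * - + 3 * - + 3) eq)

sum-of-cubes-factorisation : ∀ a b c →
  a * a * a + b * b * b + c * c * c - + 3 * a * b * c
    ≡ (a + b + c) * (a * a + b * b + c * c - a * b - b * c - c * a)
sum-of-cubes-factorisation = solve-∀

cube+27-as-sum-of-cubes : ∀ d x y → let a = + 3 * x; b = + 3 * y; c = - d in
  d * d * d + + 27
    ≡ + 27 * (x * x * x + y * y * y + d * x * y + + 1)
      - (a * a * a + b * b * b + c * c * c - + 3 * a * b * c)
cube+27-as-sum-of-cubes = solve-∀

linearFactor∣cube+27 : ∀ d x y → x * x * x + y * y * y + d * x * y + + 1 ≡ 0ℤ →
  + 3 * x + + 3 * y - d Signed.∣ d * d * d + + 27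
linearFactor∣cube+27 d x y onCurve =
  subst (d₁ Signed.∣_) (sym (cube+27-as-sum-of-cubes d x y)) (∣m∣n⇒∣m-n d₁∣27E d₁∣S)
  where
  a b c d₁ : ℤ
  a  = + 3 * x
  b  = + 3 * y
  c  = - d
  d₁ = a + b + c
  d₁∣27E : d₁ Signed.∣ + 27 * (x * x * x + y * y * y + d * x * y + + 1)
  d₁∣27E = ∣n⇒∣m*n (+ 27) (subst (d₁ Signed.∣_) (sym onCurve) (divides 0ℤ refl))
  d₁∣S : d₁ Signed.∣ a * a * a + b * b * b + c * c * c - + 3 * a * b * c
  d₁∣S = subst (d₁ Signed.∣_) (sym (sum-of-cubes-factorisation a b c)) (∣m⇒∣m*n _ ∣-refl)

radicand-as-discriminant : ∀ d x y →
  let d₁ = + 3 * x + + 3 * y - d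
      t  = + 18 * d₁ * x - (+ 3 * d * d₁ + + 3 * (d₁ * d₁))
  in t * t - radicand d d₁ ≡ + 324 * d₁ * (x * x * x + y * y * y + d * x * y + + 1)
radicand-as-discriminant = identity
  where
  -- The ring solver treats radicand as an opaque constant, so it is unfolded by hand.
  identity : ∀ d x y →
    let d₁ = + 3 * x + + 3 * y - d
        t  = + 18 * d₁ * x - (+ 3 * d * d₁ + + 3 * (d₁ * d₁))
    in t * t - (- (+ 27) * (d * d) * (d₁ * d₁) - (+ 18) * d * (d₁ * d₁ * d₁)
                - (+ 3) * (d₁ * d₁ * d₁ * d₁) - (+ 12) * (d * d * d + + 27) * d₁)
       ≡ + 324 * d₁ * (x * x * x + y * y * y + d * x * y + + 1)
  identity = solve-∀

plus-or-minus-root : ∀ {i j k} t → i ≡ j + t → t * t ≡ k →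
  ∃[ s ] (0ℤ ≤ s × s * s ≡ k × (i ≡ j + s ⊎ i ≡ j - s))
plus-or-minus-root (+ n)    i≡j+t t²≡k = + n , +≤+ ℕ.z≤n , t²≡k , inj₁ i≡j+t
plus-or-minus-root -[1+ n ] i≡j+t t²≡k = + ℕ.suc n , +≤+ ℕ.z≤n , t²≡k , inj₂ i≡j+t

i≡j+[i-j] : ∀ i j → i ≡ j + (i - j)
i≡j+[i-j] = solve-∀

3y≡d+[3x+3y-d]-3x : ∀ d x y → + 3 * y ≡ d + (+ 3 * x + + 3 * y - d) - + 3 * x
3y≡d+[3x+3y-d]-3x = solve-∀

theorem4p1 : (d x y : ℤ) → d ≢ - (+ 3) →
  x * x * x + y * y * y + d * x * y + + 1 ≡ 0ℤ →
  ∃[ d₁ ] (d₁ ≢ 0ℤ × d₁ ∣ (d * d * d + + 27) ×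
    ∃[ s ] (0ℤ ≤ s × s * s ≡ radicand d d₁ ×
      ((+ 18 * d₁ * x ≡ + 3 * d * d₁ + + 3 * (d₁ * d₁) + s)
       ⊎ (+ 18 * d₁ * x ≡ + 3 * d * d₁ + + 3 * (d₁ * d₁) - s)) ×
      + 3 * y ≡ d + d₁ - + 3 * x))
theorem4p1 d x y d≢-3 onCurve =
  let s , 0≤s , s²≡radicand , x-formula =
        plus-or-minus-root {j = centre} t (i≡j+[i-j] (+ 18 * d₁ * x) centre) t²≡radicand
  in d₁ , d₁≢0 , ∣⇒∣ᵤ d₁∣cube+27 , s , 0≤s , s²≡radicand , x-formula , 3y≡d+[3x+3y-d]-3x d x y
  where
  open ≡-Reasoning
  d₁ centre t : ℤ
  d₁     = + 3 * x + + 3 * y - d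
  centre = + 3 * d * d₁ + + 3 * (d₁ * d₁)
  t      = + 18 * d₁ * x - centre
  d₁∣cube+27 : d₁ Signed.∣ d * d * d + + 27
  d₁∣cube+27 = linearFactor∣cube+27 d x y onCurve
  d₁≢0 : d₁ ≢ 0ℤ
  d₁≢0 d₁≡0 = d≢-3 (cube+27≡0⇒≡-3 d (0∣⇒≡0 (subst (Signed._∣ _) d₁≡0 d₁∣cube+27)))
  t²≡radicand : t * t ≡ radicand d d₁
  t²≡radicand = i-j≡0⇒i≡j (t * t) (radicand d d₁) (begin
    t * t - radicand d d₁                                     ≡⟨ radicand-as-discriminant d x y ⟩
    + 324 * d₁ * (x * x * x + y * y * y + d * x * y + + 1)  ≡⟨ cong (+ 324 * d₁ *_) onCurve ⟩
    + 324 * d₁ * 0ℤ                                           ≡⟨ *-zeroʳ (+ 324 * d₁) ⟩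
    0ℤ                                                        ∎)
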